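{- Let $(p_k)_{k\ge1}$ be an unbounded sequence of positive integers (not necessarily increasing). In the flashcard game with insertion sequence $(p_k)$, for every $n\ge1$, \[ T_n(1)\le 1+(n-1)\cdot\min\{j\ge1 : p_j\ge n\}. \]
   Context: Let $(p_k)_{k\ge1}$ be a sequence of positive integers (the insertion sequence). The flashcard game with insertion sequence $(p_k)$ is the following deterministic process. The state at each time $t=1,2,\dots$ consists of an ordering (the deck) of all positive integers (cards), positions numbered $1,2,\dots$ from the front, together with a counter for each card recording how many times it has been seen. At time $t=1$ the deck is $1,2,3,\dots$, card $1$ (at the front) has been seen once, and all other cards $0$ times. To pass from time $t$ to $t+1$: if the front card has been seen $k$ times so far, remove it and reinsert it so that it occupies position $p_k$; then the card now at the front has its counter increased by one (it is seen at time $t+1$). For $n,k\ge1$, $T_n(k)$ denotes the time at which card $n$ is seen for the $k$-th time. -}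

module Defs where

open import Data.Nat using (ℕ; zero; suc; _+_; _*_; _∸_; _≤_; _<_; _<ᵇ_; _≡ᵇ_)
open import Data.Bool using (Bool; true; false; if_then_else_)

-- Cards are the positive integers 1,2,3,...
-- A deck is an ordering of all cards, given as a function
--   position ↦ card,
-- where positions are 0-indexed here: index i is position i+1 (index 0 = front).
Deck : Set
Deck = ℕ → ℕ

-- Counters: card ↦ number of times it has been seen so far.
Counter : Set
Counter = ℕ → ℕ

record State : Set where
  constructor ⟨_,_⟩
  field
    deck  : Deck
    count : Counter
open State public

front : State → ℕ
front s = deck s 0

-- Remove the front card of d and reinsert it so that it occupies position p
-- (1-indexed, p ≥ 1), i.e. index q = p ∸ 1.
-- Cards at indices 1..q move up by one; cards beyond index q stay put.
reinsert : ℕ → Deck → Deck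
reinsert p d i =
  if i <ᵇ (p ∸ 1) then d (suc i)
  else if i ≡ᵇ (p ∸ 1) then d 0
  else d i

bump : ℕ → Counter → Counter
bump c cnt m = if m ≡ᵇ c then suc (cnt m) else cnt m

-- Initial state (time 1): deck 1,2,3,...; card 1 seen once, others 0 times.
initial : State
initial = ⟨ (λ i → suc i) , (λ m → if m ≡ᵇ 1 then 1 else 0) ⟩

-- One step from time t to t+1 with insertion sequence p (p k = p_k for k ≥ 1):
-- the front card, seen k times so far, is reinserted at position p_k;
-- then the new front card has its counter increased by one.
step : (ℕ → ℕ) → State → State
step p s =
  let c  = front s
      k  = count s c
      d' = reinsert (p k) (deck s)
  in ⟨ d' , bump (d' 0) (count s) ⟩

-- gameAt p t = state at time t+1  (so gameAt p 0 is the state at time 1).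
gameAt : (ℕ → ℕ) → ℕ → State
gameAt p zero    = initial
gameAt p (suc t) = step p (gameAt p t)

SeenAt : (ℕ → ℕ) → ℕ → ℕ → Set
SeenAt p n t = 1 ≤ t × front (gameAt p (t ∸ 1)) ≡ n
  where
  open import Data.Product using (_×_)
  open import Relation.Binary.PropositionalEquality using (_≡_)

IsFirstSeen : (ℕ → ℕ) → ℕ → ℕ → Set
IsFirstSeen p n t = SeenAt p n t × (∀ s → s < t → ¬ SeenAt p n s)
  where
  open import Data.Product using (_×_)
  open import Relation.Nullary using (¬_)

IsMinIndex : (ℕ → ℕ) → ℕ → ℕ → Set
IsMinIndex p n j = 1 ≤ j × n ≤ p j × (∀ i → 1 ≤ i → i < j → p i < n)
  where
  open import Data.Product using (_×_)

-- Follow card n until it first reaches the front. Every card ahead of it is one of 1, …, n − 1,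
-- and every such card other than the front one has been seen fewer than j times: a card that
-- gets reinserted ahead of n was put at a position p_k < n, so k < j by minimality of j.
-- Hence each step that does not bring n to the front shows some card x < n for at most its
-- j-th time, so the potential Σ_{1 ≤ x < n} (j − #seen x), which starts at (n − 1) j − 1,
-- strictly decreases, and n reaches the front within (n − 1) j steps.

module Submission where

open import Defs
open import Data.Nat using (ℕ; zero; suc; _+_; _*_; _∸_; _≤_; _<_; _<ᵇ_; _≡ᵇ_; z≤n; s≤s; z<s; s<s)
open import Data.Nat.Properties
open import Data.Bool using (true; false; if_then_else_)
open import Data.Bool.Properties using (T-≡; ¬-not)
open import Data.Product using (_×_; ∃-syntax; _,_; proj₁; proj₂)
open import Data.Sum using (_⊎_; inj₁; inj₂)
open import Function.Bundles using (Equivalence)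
open import Function.Definitions using (Injective)
open import Relation.Nullary using (¬_; yes; no; contradiction)
open import Relation.Unary using (Decidable)
open import Relation.Binary using (tri<; tri≈; tri>)
open import Relation.Binary.PropositionalEquality

<ᵇ-true : ∀ {m n} → m < n → (m <ᵇ n) ≡ true
<ᵇ-true m<n = Equivalence.to T-≡ (<⇒<ᵇ m<n)

<ᵇ-false : ∀ {m n} → n ≤ m → (m <ᵇ n) ≡ false
<ᵇ-false {m} {n} n≤m = ¬-not (λ e → ≤⇒≯ n≤m (<ᵇ⇒< m n (Equivalence.from T-≡ e)))

≡ᵇ-true : ∀ {m n} → m ≡ n → (m ≡ᵇ n) ≡ true
≡ᵇ-true {m} {n} m≡n = Equivalence.to T-≡ (≡⇒≡ᵇ m n m≡n)

≡ᵇ-false : ∀ {m n} → m ≢ n → (m ≡ᵇ n) ≡ false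
≡ᵇ-false {m} {n} m≢n = ¬-not (λ e → m≢n (≡ᵇ⇒≡ m n (Equivalence.from T-≡ e)))

cut : ℕ → ℕ → ℕ
cut q i = if i <ᵇ q then suc i else if i ≡ᵇ q then 0 else i

reinsert-cut : ∀ P d i → reinsert P d i ≡ d (cut (P ∸ 1) i)
reinsert-cut P d i with i <ᵇ (P ∸ 1)
... | true = refl
... | false with i ≡ᵇ (P ∸ 1)
...   | true = refl
...   | false = refl

cut-< : ∀ {q i} → i < q → cut q i ≡ suc i
cut-< i<q rewrite <ᵇ-true i<q = refl

cut-≡ : ∀ q → cut q q ≡ 0
cut-≡ q rewrite <ᵇ-false (≤-refl {q}) | ≡ᵇ-true (refl {x = q}) = refl

cut-> : ∀ {q i} → q < i → cut q i ≡ i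
cut-> q<i rewrite <ᵇ-false (<⇒≤ q<i) | ≡ᵇ-false (>⇒≢ q<i) = refl

uncut : ℕ → ℕ → ℕ
uncut q zero    = q
uncut q (suc i) = if i <ᵇ q then i else suc i

uncut-cut : ∀ q i → uncut q (cut q i) ≡ i
uncut-cut q i with <-cmp i q
... | tri< i<q _ _ rewrite cut-< i<q | <ᵇ-true i<q = refl
... | tri≈ _ refl _ rewrite cut-≡ q = refl
uncut-cut q (suc i) | tri> _ _ q<i rewrite cut-> q<i | <ᵇ-false (≤-pred q<i) = refl

reinsert-injective : ∀ P d → Injective _≡_ _≡_ d → Injective _≡_ _≡_ (reinsert P d)
reinsert-injective P d d-inj {a} {b} e = begin
  a                   ≡⟨ sym (uncut-cut q a) ⟩
  uncut q (cut q a)   ≡⟨ cong (uncut q) (d-inj (trans (sym (reinsert-cut P d a)) (trans e (reinsert-cut P d b)))) ⟩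
  uncut q (cut q b)   ≡⟨ uncut-cut q b ⟩
  b                   ∎
  where
  open ≡-Reasoning
  q = P ∸ 1

reinsert-< : ∀ P d {i} → i < P ∸ 1 → reinsert P d i ≡ d (suc i)
reinsert-< P d {i} i<q = trans (reinsert-cut P d i) (cong d (cut-< i<q))

reinsert-≡ : ∀ P d → reinsert P d (P ∸ 1) ≡ d 0
reinsert-≡ P d = trans (reinsert-cut P d (P ∸ 1)) (cong d (cut-≡ (P ∸ 1)))

reinsert-> : ∀ P d {i} → P ∸ 1 < i → reinsert P d i ≡ d i
reinsert-> P d {i} q<i = trans (reinsert-cut P d i) (cong d (cut-> q<i))

reinsert-ahead : ∀ (R : ℕ → Set) P d {m n} → d m ≡ n → 1 ≤ m →
                 (∀ i → 1 ≤ i → i < m → R (d i)) → (P ∸ 1 < m → R (d 0)) →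
                 ∃[ m′ ] (m′ ≤ m × reinsert P d m′ ≡ n × (∀ i → i < m′ → R (reinsert P d i)))
reinsert-ahead R P d {suc m} dm≡n _ ahead front with m <? P ∸ 1
... | yes m<q = m , n≤1+n m , trans (reinsert-< P d m<q) dm≡n , before
  where
  before : ∀ i → i < m → R (reinsert P d i)
  before i i<m = subst R (sym (reinsert-< P d (<-trans i<m m<q))) (ahead (suc i) (s≤s z≤n) (s<s i<m))
... | no m≮q = suc m , ≤-refl , trans (reinsert-> P d q<1+m) dm≡n , before
  where
  q<1+m : P ∸ 1 < suc m
  q<1+m = s≤s (≮⇒≥ m≮q)
  before : ∀ i → i < suc m → R (reinsert P d i)
  before i i<1+m with <-cmp i (P ∸ 1)
  ... | tri< i<q _ _ = subst R (sym (reinsert-< P d i<q)) (ahead (suc i) (s≤s z≤n) (<-≤-trans (s<s i<q) q<1+m))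
  ... | tri≈ _ refl _ = subst R (sym (reinsert-≡ P d)) (front q<1+m)
  ... | tri> _ _ q<i = subst R (sym (reinsert-> P d q<i)) (ahead i (≤-<-trans z≤n q<i) i<1+m)

bump-self : ∀ y c → bump y c y ≡ suc (c y)
bump-self y c rewrite ≡ᵇ-true (refl {x = y}) = refl

bump-other : ∀ y c {x} → x ≢ y → bump y c x ≡ c x
bump-other y c x≢y rewrite ≡ᵇ-false x≢y = refl

bump-≥ : ∀ y c x → c x ≤ bump y c x
bump-≥ y c x with x ≡ᵇ y
... | true  = n≤1+n (c x)
... | false = ≤-refl

sumBelow : ℕ → (ℕ → ℕ) → ℕ
sumBelow zero    f = 0
sumBelow (suc N) f = f 0 + sumBelow N (λ x → f (suc x))

sumBelow-mono-≤ : ∀ N {f g} → (∀ x → f x ≤ g x) → sumBelow N f ≤ sumBelow N g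
sumBelow-mono-≤ zero    f≤g = z≤n
sumBelow-mono-≤ (suc N) f≤g = +-mono-≤ (f≤g 0) (sumBelow-mono-≤ N (λ x → f≤g (suc x)))

sumBelow-mono-< : ∀ N {f g y} → (∀ x → f x ≤ g x) → y < N → f y < g y → sumBelow N f < sumBelow N g
sumBelow-mono-< (suc N) {y = zero}  f≤g _         fy<gy = +-mono-<-≤ fy<gy (sumBelow-mono-≤ N (λ x → f≤g (suc x)))
sumBelow-mono-< (suc N) {y = suc y} f≤g (s<s y<N) fy<gy = +-mono-≤-< (f≤g 0) (sumBelow-mono-< N (λ x → f≤g (suc x)) y<N fy<gy)

sumBelow-const : ∀ N a → sumBelow N (λ _ → a) ≡ N * a
sumBelow-const zero    a = refl
sumBelow-const (suc N) a = cong (a +_) (sumBelow-const N a)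

least-witness : ∀ {P : ℕ → Set} → Decidable P → ∀ B → ∃[ t ] (t ≤ B × P t) →
                ∃[ s ] (s ≤ B × P s × (∀ r → r < s → ¬ P r))
least-witness P? zero (t , t≤0 , Pt) = t , t≤0 , Pt , λ r r<t → contradiction (<-≤-trans r<t t≤0) n≮0
least-witness P? (suc B) (t , t≤1+B , Pt) with anyUpTo? P? (suc B)
... | yes (r , r<1+B , Pr) =
  let s , s≤B , Ps , below = least-witness P? B (r , ≤-pred r<1+B , Pr)
  in s , m≤n⇒m≤1+n s≤B , Ps , below
... | no none = t , t≤1+B , Pt , λ r r<t Pr → none (r , <-≤-trans r<t t≤1+B , Pr)

module Descent {A : Set} (x : ℕ → A) (Inv Goal : A → Set) (Φ : A → ℕ)
               (progress : ∀ t → Inv (x t) → Goal (x (suc t)) ⊎ (Inv (x (suc t)) × Φ (x (suc t)) < Φ (x t)))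
               (inv₀ : Inv (x 0)) where

  goal-or-descent : ∀ T → (∃[ t ] (t < T × Goal (x (suc t)))) ⊎ (Inv (x T) × Φ (x T) + T ≤ Φ (x 0))
  goal-or-descent zero = inj₂ (inv₀ , ≤-reflexive (+-identityʳ _))
  goal-or-descent (suc T) with goal-or-descent T
  ... | inj₁ (t , t<T , goal) = inj₁ (t , m<n⇒m<1+n t<T , goal)
  ... | inj₂ (inv , bound) with progress T inv
  ...   | inj₁ goal = inj₁ (T , n<1+n T , goal)
  ...   | inj₂ (inv′ , Φ<) = inj₂ (inv′ , ≤-trans (≤-reflexive (+-suc (Φ (x (suc T))) T)) (≤-trans (+-monoˡ-≤ T Φ<) bound))

  goal-within-Φ : ∃[ t ] (t ≤ Φ (x 0) × Goal (x (suc t)))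
  goal-within-Φ with goal-or-descent (suc (Φ (x 0)))
  ... | inj₁ (t , t<1+Φ₀ , goal) = t , ≤-pred t<1+Φ₀ , goal
  ... | inj₂ (_ , bound) = contradiction (≤-trans (m≤n+m _ _) bound) (n≮n _)

first-seen : ∀ p n s → front (gameAt p s) ≡ n → (∀ r → r < s → front (gameAt p r) ≢ n) →
             IsFirstSeen p n (suc s)
first-seen p n s seen earlier = (s≤s z≤n , seen) , not-seen-before
  where
  not-seen-before : ∀ r → r < suc s → ¬ SeenAt p n r
  not-seen-before zero    _      (() , _)
  not-seen-before (suc r) r<1+s (_ , seen-r) = earlier r (≤-pred r<1+s) seen-r

module Game (p : ℕ → ℕ) (N j : ℕ) (j-min : IsMinIndex p (suc (suc N)) j) where

  n : ℕ
  n = suc (suc N)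

  Fresh : Counter → ℕ → Set
  Fresh c x = 1 ≤ x × x < n × c x < j

  record Waiting (s : State) (m : ℕ) : Set where
    field
      deck-injective : Injective _≡_ _≡_ (deck s)
      position       : deck s m ≡ n
      not-front      : 1 ≤ m
      position<n     : m < n
      front-range    : 1 ≤ front s × front s < n
      front-count    : count s (front s) ≤ j
      ahead-fresh    : ∀ i → 1 ≤ i → i < m → Fresh (count s) (deck s i)

  Ψ : Counter → ℕ
  Ψ c = sumBelow (suc N) (λ x → j ∸ c (suc x))

  Ψ-bump : ∀ c {y} → Fresh c y → Ψ (bump y c) < Ψ c
  Ψ-bump c {suc y} (_ , s<s y<1+N , cy<j) =
    sumBelow-mono-< (suc N) (λ x → ∸-monoʳ-≤ j (bump-≥ (suc y) c (suc x))) y<1+N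
      (subst (λ k → j ∸ k < j ∸ c (suc y)) (sym (bump-self (suc y) c)) (∸-monoʳ-< (n<1+n _) cy<j))

  Fresh-bump : ∀ c {x y} → x ≢ y → Fresh c x → Fresh (bump y c) x
  Fresh-bump c {y = y} x≢y (1≤x , x<n , cx<j) = 1≤x , x<n , subst (_< j) (sym (bump-other y c x≢y)) cx<j

  below-threshold : ∀ {k} → k ≤ j → p k < n → k < j
  below-threshold k≤j pk<n = ≤∧≢⇒< k≤j λ { refl → <⇒≱ pk<n (proj₁ (proj₂ j-min)) }

  reinserted-ahead-fresh : ∀ {s m} → Waiting s m → p (count s (front s)) ∸ 1 < m → Fresh (count s) (front s)
  reinserted-ahead-fresh {s} {m} w q<m = 1≤front , front<n , below-threshold front-count pk<n
    where
    open Waiting w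
    1≤front = proj₁ front-range
    front<n = proj₂ front-range
    P = p (count s (front s))
    pk<n : P < n
    pk<n = ≤-<-trans (≤-trans (m≤n+m∸n P 1) q<m) position<n

  step-progress : ∀ s {m} → Waiting s m →
                  front (step p s) ≡ n ⊎ ((∃[ m′ ] Waiting (step p s) m′) × Ψ (count (step p s)) < Ψ (count s))
  step-progress s {m} w = conclude (reinsert-ahead (Fresh c) P d position not-front ahead-fresh (reinserted-ahead-fresh w))
    where
    open Waiting w
    d = deck s
    c = count s
    P = p (c (d 0))
    d′ = reinsert P d
    d′-injective : Injective _≡_ _≡_ d′
    d′-injective = reinsert-injective P d deck-injective
    conclude : ∃[ m′ ] (m′ ≤ m × d′ m′ ≡ n × (∀ i → i < m′ → Fresh c (d′ i))) →
               front (step p s) ≡ n ⊎ ((∃[ m′ ] Waiting (step p s) m′) × Ψ (count (step p s)) < Ψ c)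
    conclude (zero , _ , n-front , _) = inj₁ n-front
    conclude (suc m′ , m′≤m , n-at , fresh) = inj₂ ((suc m′ , waiting′) , Ψ-bump c y-fresh)
      where
      y-fresh = fresh 0 z<s
      waiting′ : Waiting (step p s) (suc m′)
      waiting′ = record
        { deck-injective = d′-injective
        ; position       = n-at
        ; not-front      = s≤s z≤n
        ; position<n     = ≤-<-trans m′≤m position<n
        ; front-range    = proj₁ y-fresh , proj₁ (proj₂ y-fresh)
        ; front-count    = subst (_≤ j) (sym (bump-self (d′ 0) c)) (proj₂ (proj₂ y-fresh))
        ; ahead-fresh    = λ i 1≤i i<1+m′ → Fresh-bump c (λ e → >⇒≢ 1≤i (d′-injective e)) (fresh i i<1+m′)
        }

  waiting-initial : Waiting initial (suc N)
  waiting-initial = record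
    { deck-injective = suc-injective
    ; position       = refl
    ; not-front      = s≤s z≤n
    ; position<n     = n<1+n (suc N)
    ; front-range    = s≤s z≤n , s≤s (s≤s z≤n)
    ; front-count    = proj₁ j-min
    ; ahead-fresh    = λ { (suc i) _ i<1+N → s≤s z≤n , s<s i<1+N , proj₁ j-min }
    }

  Ψ-initial : suc (Ψ (count initial)) ≡ suc N * j
  Ψ-initial = begin
    suc ((j ∸ 1) + sumBelow N (λ _ → j)) ≡⟨ cong (_+ sumBelow N (λ _ → j)) (m+[n∸m]≡n (proj₁ j-min)) ⟩
    j + sumBelow N (λ _ → j)             ≡⟨ cong (j +_) (sumBelow-const N j) ⟩
    j + N * j                            ∎
    where open ≡-Reasoning

  first-seen-bound : ∃[ t ] (IsFirstSeen p n t × t ≤ 1 + suc N * j)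
  first-seen-bound =
    let t , t≤Ψ₀ , seen-at-1+t = goal-within-Φ
        s , s≤1+Ψ₀ , seen-at-s , not-before-s =
          least-witness (λ r → front (gameAt p r) ≟ n) (suc (Ψ (count initial))) (suc t , s≤s t≤Ψ₀ , seen-at-1+t)
    in suc s , first-seen p n s seen-at-s not-before-s , s≤s (subst (s ≤_) Ψ-initial s≤1+Ψ₀)
    where
    open Descent (gameAt p) (λ s → ∃[ m ] Waiting s m) (λ s → front s ≡ n) (λ s → Ψ (count s))
                 (λ t (_ , w) → step-progress (gameAt p t) w) (suc N , waiting-initial)

-- The positivity and unboundedness of p only serve to guarantee that j exists; here j is given.
mainTheorem13 : (p : ℕ → ℕ)
    → (∀ k → 1 ≤ k → 1 ≤ p k)
    → (∀ m → ∃[ j ] (1 ≤ j × m ≤ p j))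
    → (n : ℕ) → 1 ≤ n
    → (j : ℕ) → IsMinIndex p n j
    → ∃[ t ] (IsFirstSeen p n t × t ≤ 1 + (n ∸ 1) * j)
mainTheorem13 p _ _ (suc zero)    _ j _     = 1 , first-seen p 1 0 refl (λ _ ()) , ≤-refl
mainTheorem13 p _ _ (suc (suc N)) _ j j-min = Game.first-seen-bound p N j j-min
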